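{- Every set $\Gamma$ of modal formulas is $\mathsf{CnK}$-satisfiable: there is a modal Fischer-Servi model and a world $w$ in it with $w\models^+\phi$ for all $\phi\in\Gamma$ (i.e. $\Gamma\not\models_{\mathsf{CnK}}\emptyset$).
   Context: Modal formulas are built from propositional letters with $\wedge,\vee,\to,\sim$ (strong negation), $\Box,\Diamond$. A modal Fischer-Servi model is $(W,\leq,R,V^+,V^-)$ with $W\neq\emptyset$, $\leq$ a preorder, $R\subseteq W\times W$, $V^\pm$ maps letters to $\leq$-upward closed subsets of $W$, satisfying (c1) $w\leq w'$, $wRv$ imply $w'Rv'$, $v\leq v'$ for some $v'$; (c2) $wRv$, $v\leq v'$ imply $w\leq w'$, $w'Rv'$ for some $w'$. Verification/falsification: $w\models^\pm p$ iff $w\in V^\pm(p)$; $\wedge$: $+$ iff both $+$, $-$ iff some $-$; $\vee$: $+$ iff some $+$, $-$ iff both $-$; $w\models^\pm\sim\psi$ iff $w\models^\mp\psi$; $w\models^+\psi\to\chi$ iff $\forall v\geq w(v\models^+\psi\Rightarrow v\models^+\chi)$; $w\models^-\psi\to\chi$ iff $\forall v\geq w(v\models^+\psi\Rightarrow v\models^-\chi)$; $w\models^\pm\Box\psi$ iff $\forall v\geq w\,\forall u(vRu\Rightarrow u\models^\pm\psi)$; $w\models^\pm\Diamond\psi$ iff $\exists u(wRu$ and $u\models^\pm\psi)$. $\Gamma\models_{\mathsf{CnK}}\Delta$ iff no world of any such model verifies all of $\Gamma$ and none of $\Delta$. -}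

module Defs where

open import Data.Nat using (ℕ)
open import Data.Product using (Σ; ∃; _×_; _,_)
open import Data.Sum using (_⊎_)
open import Level using (Level; suc; _⊔_; 0ℓ)

data Formula : Set where
  var  : ℕ → Formula
  _∧_  : Formula → Formula → Formula
  _∨_  : Formula → Formula → Formula
  _⇒_  : Formula → Formula → Formula
  ∼_   : Formula → Formula          -- strong negation
  □_   : Formula → Formula
  ◇_   : Formula → Formula

record FSModel : Set₁ where
  field
    W      : Set
    inhabited : W
    _≤_    : W → W → Set
    ≤-refl  : ∀ {w} → w ≤ w
    ≤-trans : ∀ {u v w} → u ≤ v → v ≤ w → u ≤ w
    R      : W → W → Set
    V⁺     : ℕ → W → Set
    V⁻     : ℕ → W → Set
    V⁺-mono : ∀ p {w w'} → w ≤ w' → V⁺ p w → V⁺ p w'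
    V⁻-mono : ∀ p {w w'} → w ≤ w' → V⁻ p w → V⁻ p w'
    c1 : ∀ {w w' v} → w ≤ w' → R w v → Σ W (λ v' → R w' v' × v ≤ v')
    c2 : ∀ {w v v'} → R w v → v ≤ v' → Σ W (λ w' → w ≤ w' × R w' v')

module _ (M : FSModel) where
  open FSModel M

  _⊨⁺_ : W → Formula → Set
  _⊨⁻_ : W → Formula → Set

  w ⊨⁺ var p   = V⁺ p w
  w ⊨⁺ (φ ∧ ψ) = (w ⊨⁺ φ) × (w ⊨⁺ ψ)
  w ⊨⁺ (φ ∨ ψ) = (w ⊨⁺ φ) ⊎ (w ⊨⁺ ψ)
  w ⊨⁺ (φ ⇒ ψ) = ∀ v → w ≤ v → v ⊨⁺ φ → v ⊨⁺ ψ
  w ⊨⁺ (∼ φ)   = w ⊨⁻ φ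
  w ⊨⁺ (□ φ)   = ∀ v → w ≤ v → ∀ u → R v u → u ⊨⁺ φ
  w ⊨⁺ (◇ φ)   = Σ W (λ u → R w u × u ⊨⁺ φ)

  w ⊨⁻ var p   = V⁻ p w
  w ⊨⁻ (φ ∧ ψ) = (w ⊨⁻ φ) ⊎ (w ⊨⁻ ψ)
  w ⊨⁻ (φ ∨ ψ) = (w ⊨⁻ φ) × (w ⊨⁻ ψ)
  w ⊨⁻ (φ ⇒ ψ) = ∀ v → w ≤ v → v ⊨⁺ φ → v ⊨⁻ ψ
  w ⊨⁻ (∼ φ)   = w ⊨⁺ φ
  w ⊨⁻ (□ φ)   = ∀ v → w ≤ v → ∀ u → R v u → u ⊨⁻ φ
  w ⊨⁻ (◇ φ)   = Σ W (λ u → R w u × u ⊨⁻ φ)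

FormulaSet : Set₁
FormulaSet = Formula → Set

CnK-Satisfiable : FormulaSet → Set₁
CnK-Satisfiable Γ =
  Σ FSModel (λ M → Σ (FSModel.W M) (λ w → ∀ φ → Γ φ → _⊨⁺_ M w φ))

{-# OPTIONS --safe #-}
module Submission where

open import Defs
open import Data.Unit using (⊤; tt)
open import Data.Product using (Σ; _,_)
open import Data.Sum using (inj₁)

-- Strong negation makes verification and falsification independent, so a world
-- may both verify and falsify every letter. In a model with such a valuation and
-- a serial accessibility relation every world then verifies and falsifies every
-- formula; the one-world reflexive model is of this kind.

module _ (M : FSModel)
         (V⁺-total : ∀ p w → FSModel.V⁺ M p w)
         (V⁻-total : ∀ p w → FSModel.V⁻ M p w)
         (R-serial : ∀ w → Σ (FSModel.W M) (FSModel.R M w))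
         where

  verifies-all  : ∀ w φ → _⊨⁺_ M w φ
  falsifies-all  : ∀ w φ → _⊨⁻_ M w φ

  verifies-all w (var p)   = V⁺-total p w
  verifies-all w (φ ∧ ψ)   = verifies-all w φ , verifies-all w ψ
  verifies-all w (φ ∨ ψ)   = inj₁ (verifies-all w φ)
  verifies-all w (φ ⇒ ψ)   = λ v _ _ → verifies-all v ψ
  verifies-all w (∼ φ)     = falsifies-all w φ
  verifies-all w (□ φ)     = λ _ _ u _ → verifies-all u φ
  verifies-all w (◇ φ)     = let (u , wRu) = R-serial w in u , wRu , verifies-all u φ

  falsifies-all w (var p)  = V⁻-total p w
  falsifies-all w (φ ∧ ψ)  = inj₁ (falsifies-all w φ)
  falsifies-all w (φ ∨ ψ)  = falsifies-all w φ , falsifies-all w ψ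
  falsifies-all w (φ ⇒ ψ)  = λ v _ _ → falsifies-all v ψ
  falsifies-all w (∼ φ)    = verifies-all w φ
  falsifies-all w (□ φ)    = λ _ _ u _ → falsifies-all u φ
  falsifies-all w (◇ φ)    = let (u , wRu) = R-serial w in u , wRu , falsifies-all u φ

trivialModel : FSModel
trivialModel = record
  { W = ⊤ ; inhabited = tt
  ; _≤_ = λ _ _ → ⊤ ; ≤-refl = tt ; ≤-trans = λ _ _ → tt
  ; R = λ _ _ → ⊤
  ; V⁺ = λ _ _ → ⊤ ; V⁻ = λ _ _ → ⊤
  ; V⁺-mono = λ _ _ _ → tt ; V⁻-mono = λ _ _ _ → tt
  ; c1 = λ _ _ → tt , tt , tt ; c2 = λ _ _ → tt , tt , tt
  }

proposition4p16 : (Γ : FormulaSet) → CnK-Satisfiable Γ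
proposition4p16 Γ =
  trivialModel , tt ,
  λ φ _ → verifies-all trivialModel (λ _ _ → tt) (λ _ _ → tt) (λ _ → tt , tt) tt φ
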